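{- For any hypergraph $H$, $z_0(\mathrm{IG}(H))=2b_L(H)+|E(H)|-|V(H)|$.
   Context: A hypergraph $H$ consists of a finite vertex set $V(H)$ and a finite collection $E(H)$ of subsets of $V(H)$. Lazy burning: a set $B\subseteq V(H)$ is burned initially; in each subsequent round every unburned vertex $v$ for which some hyperedge $h\ni v$ has $h\setminus\{v\}$ entirely burned becomes burned; $b_L(H)$ is the minimum size of an initial set from which all vertices eventually burn. The incidence graph $\mathrm{IG}(H)$ is the bipartite graph on $V(H)\cup E(H)$ with $v\sim h$ iff $v\in h$. Skew zero forcing on a graph $G$: an initial set of vertices is black, the rest white; repeatedly, any vertex $u$ (black or white) with exactly one white neighbor $w$ turns $w$ black; $z_0(G)$ is the minimum size of an initial black set from which all vertices eventually become black. -}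

module Defs where

open import Data.Nat using (ℕ; _+_; _*_; _≤_)
open import Data.Fin using (Fin; splitAt)
open import Data.Fin.Subset using (Subset; _∈_; ∣_∣)
open import Data.Sum using (_⊎_; inj₁; inj₂)
open import Data.Product using (Σ; _×_)
open import Data.Empty using (⊥)
open import Relation.Nullary using (¬_)
open import Relation.Binary.PropositionalEquality using (_≡_; _≢_)

-- A hypergraph: vertex set Fin n, a finite collection (indexed family,
-- repetitions allowed) of m hyperedges, each a subset of the vertices.
record Hypergraph : Set where
  field
    nV    : ℕ
    nE    : ℕ
    edge  : Fin nE → Subset nV

record Graph : Set₁ where
  field
    N        : ℕ
    adj      : Fin N → Fin N → Set
    adj-sym  : ∀ x y → adj x y → adj y x
    adj-irr  : ∀ x → ¬ adj x x

-- Burned H B v : v is eventually burned from initial set B.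
-- (The limit of the round-by-round process is the least set containing B
-- closed under the rule, since the rule is monotone.)

data Burned (H : Hypergraph) (B : Subset (Hypergraph.nV H)) : Fin (Hypergraph.nV H) → Set where
  initial : ∀ {v} → v ∈ B → Burned H B v
  spread  : ∀ {v} (h : Fin (Hypergraph.nE H)) → v ∈ Hypergraph.edge H h →
            (∀ u → u ∈ Hypergraph.edge H h → u ≢ v → Burned H B u) → Burned H B v

LazyBurningSet : (H : Hypergraph) → Subset (Hypergraph.nV H) → Set
LazyBurningSet H B = ∀ v → Burned H B v

IsLazyBurningNumber : Hypergraph → ℕ → Set
IsLazyBurningNumber H k =
  Σ (Subset (Hypergraph.nV H)) (λ B → LazyBurningSet H B × ∣ B ∣ ≡ k)
  × (∀ B → LazyBurningSet H B → k ≤ ∣ B ∣)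

-- Skew zero forcing.  Black G S w : w eventually becomes black from S.
-- Rule: a vertex u (any colour) whose only white neighbour is w forces w.

data Black (G : Graph) (S : Subset (Graph.N G)) : Fin (Graph.N G) → Set where
  initial : ∀ {w} → w ∈ S → Black G S w
  force   : ∀ {w} (u : Fin (Graph.N G)) → Graph.adj G u w →
            (∀ x → Graph.adj G u x → x ≢ w → Black G S x) → Black G S w

SkewForcingSet : (G : Graph) → Subset (Graph.N G) → Set
SkewForcingSet G S = ∀ w → Black G S w

IsSkewZeroForcingNumber : Graph → ℕ → Set
IsSkewZeroForcingNumber G k =
  Σ (Subset (Graph.N G)) (λ S → SkewForcingSet G S × ∣ S ∣ ≡ k)
  × (∀ S → SkewForcingSet G S → k ≤ ∣ S ∣)

-- Incidence graph: vertices Fin (nV + nE); the first nV are the vertices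
-- of H, the last nE are the hyperedges.

module _ {n m : ℕ} (edge : Fin m → Subset n) where
  IGadj′ : Fin n ⊎ Fin m → Fin n ⊎ Fin m → Set
  IGadj′ (inj₁ v) (inj₁ _) = ⊥
  IGadj′ (inj₁ v) (inj₂ h) = v ∈ edge h
  IGadj′ (inj₂ h) (inj₁ v) = v ∈ edge h
  IGadj′ (inj₂ _) (inj₂ _) = ⊥

  IGadj′-sym : ∀ x y → IGadj′ x y → IGadj′ y x
  IGadj′-sym (inj₁ v) (inj₂ h) p = p
  IGadj′-sym (inj₂ h) (inj₁ v) p = p

  IGadj′-irr : ∀ x → ¬ IGadj′ x x
  IGadj′-irr (inj₁ v) ()
  IGadj′-irr (inj₂ h) ()

IG : Hypergraph → Graph
IG H = record
  { N       = nV + nE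
  ; adj     = λ x y → IGadj′ edge (splitAt nV x) (splitAt nV y)
  ; adj-sym = λ x y → IGadj′-sym edge (splitAt nV x) (splitAt nV y)
  ; adj-irr = λ x → IGadj′-irr edge (splitAt nV x)
  }
  where open Hypergraph H

-- Run a lazy burning set B in order: each of the n − |B| other vertices burns through some edge;
-- call these edges U.  Then B together with the edges outside U skew-forces IG(H): vertices turn
-- black as they burn (an edge with one white neighbour forces it), and afterwards every edge of U
-- is forced by the vertex it burned, in reverse order of burning.  So z ≤ 2b + m − n.
-- Conversely, in a skew forcing process from S the vertex part of S burns H, since a vertex is only
-- ever forced by an edge.  Each edge outside S is forced by its own vertex, and deleting these
-- m − |S ∩ E| forcing vertices from V leaves a lazy burning set as well, burning them back in
-- reverse order of forcing.  Adding the two bounds on b gives 2b ≤ z + n − m.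

module Submission where

open import Defs
open import Data.Nat using (ℕ; suc; _+_; _*_; _≤_; z≤n; s≤s; s≤s⁻¹)
open import Data.Nat.Properties
  using (≤-antisym; m≤n⇒m≤1+n; +-suc; +-comm; +-monoˡ-≤; +-monoʳ-≤; +-mono-≤; m∸n+n≡m; module ≤-Reasoning)
open import Data.Nat.Tactic.RingSolver using (solve-∀)
open import Data.Fin using (Fin; _↑ˡ_; _↑ʳ_; splitAt)
open import Data.Fin.Properties
  using (any?; splitAt-↑ˡ; splitAt-↑ʳ; splitAt⁻¹-↑ˡ; splitAt⁻¹-↑ʳ; ↑ˡ-injective; ↑ʳ-injective)
  renaming (_≟_ to _≟ᶠ_)
open import Data.Fin.Subset
  using (Subset; inside; outside; _∈_; _∉_; _⊆_; _⊂_; _⊃_; _∪_; ⁅_⁆; _-_; ∁; ∣_∣; ⊤)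
  renaming (⊥ to ∅)
open import Data.Fin.Subset.Properties
  using (_∈?_; ∈⊤; ∉⊥; ∣⊤∣≡n; ∣⊥∣≡0; ∣⁅x⁆∣≡1; p⊆q⇒∣p∣≤∣q∣; drop-∷-⊆; p⊆p∪q; x∈p∪q⁺; x∈p∪q⁻;
         x∈⁅x⁆; x∈⁅y⁆⇒x≡y; ∣∁p∣≡n∸∣p∣; ∣p∣≤n; x∉p⇒x∈∁p; x∈p∧x≢y⇒x∈p-y; x∈p⇒∣p-x∣<∣p∣; p⊂q⇒∣p∣<∣q∣)
open import Data.Fin.Subset.Induction using (Acc; acc; ⊃-wellFounded)
open import Data.Vec using ([]; _∷_; _++_; here; there)
import Data.Vec as Vec
open import Data.Sum using (_⊎_; inj₁; inj₂)
import Data.Sum as Sum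
open import Data.Product using (∃; ∃₂; _×_; _,_)
open import Function using (_∘_; id)
open import Relation.Nullary using (Dec; ¬_; yes; no; ¬?; contradiction)
open import Relation.Nullary.Decidable using (_×-dec_; decidable-stable)
open import Relation.Binary.Definitions using (Decidable)
open import Relation.Binary.PropositionalEquality using (_≡_; _≢_; refl; sym; trans; cong; subst)

-- Finite subsets

private
  variable
    n m : ℕ

∣p∪q∣≤∣p∣+∣q∣ : (p q : Subset n) → ∣ p ∪ q ∣ ≤ ∣ p ∣ + ∣ q ∣
∣p∪q∣≤∣p∣+∣q∣ []            []            = z≤n
∣p∪q∣≤∣p∣+∣q∣ (outside ∷ p) (outside ∷ q) = ∣p∪q∣≤∣p∣+∣q∣ p q
∣p∪q∣≤∣p∣+∣q∣ (outside ∷ p) (inside  ∷ q) =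
  subst (suc ∣ p ∪ q ∣ ≤_) (sym (+-suc ∣ p ∣ ∣ q ∣)) (s≤s (∣p∪q∣≤∣p∣+∣q∣ p q))
∣p∪q∣≤∣p∣+∣q∣ (inside  ∷ p) (outside ∷ q) = s≤s (∣p∪q∣≤∣p∣+∣q∣ p q)
∣p∪q∣≤∣p∣+∣q∣ (inside  ∷ p) (inside  ∷ q) =
  s≤s (subst (∣ p ∪ q ∣ ≤_) (sym (+-suc ∣ p ∣ ∣ q ∣)) (m≤n⇒m≤1+n (∣p∪q∣≤∣p∣+∣q∣ p q)))

∣p∪⁅x⁆∣≤1+∣p∣ : (p : Subset n) (x : Fin n) → ∣ p ∪ ⁅ x ⁆ ∣ ≤ suc ∣ p ∣
∣p∪⁅x⁆∣≤1+∣p∣ p x = subst (∣ p ∪ ⁅ x ⁆ ∣ ≤_) (trans (cong (∣ p ∣ +_) (∣⁅x⁆∣≡1 x)) (+-comm ∣ p ∣ 1))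
                        (∣p∪q∣≤∣p∣+∣q∣ p ⁅ x ⁆)

x∈p∪⁅y⁆⁻ : ∀ {p : Subset n} {x y} → x ∈ p ∪ ⁅ y ⁆ → x ∈ p ⊎ x ≡ y
x∈p∪⁅y⁆⁻ {p = p} {y = y} = Sum.map₂ (x∈⁅y⁆⇒x≡y y) ∘ x∈p∪q⁻ p ⁅ y ⁆

x∉p∧x≢y⇒x∉p∪⁅y⁆ : ∀ {p : Subset n} {x y} → x ∉ p → x ≢ y → x ∉ p ∪ ⁅ y ⁆
x∉p∧x≢y⇒x∉p∪⁅y⁆ x∉p x≢y = Sum.[ x∉p , x≢y ] ∘ x∈p∪⁅y⁆⁻

x∉p⇒p⊂p∪⁅x⁆ : ∀ {p : Subset n} {x} → x ∉ p → p ⊂ p ∪ ⁅ x ⁆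
x∉p⇒p⊂p∪⁅x⁆ {x = x} x∉p = p⊆p∪q ⁅ x ⁆ , x , x∈p∪q⁺ (inj₂ (x∈⁅x⁆ x)) , x∉p

∣∁p∣+∣p∣≡n : (p : Subset n) → ∣ ∁ p ∣ + ∣ p ∣ ≡ n
∣∁p∣+∣p∣≡n p = trans (cong (_+ ∣ p ∣) (∣∁p∣≡n∸∣p∣ p)) (m∸n+n≡m (∣p∣≤n p))

∀∈⇒n≤∣p∣ : ∀ {p : Subset n} → (∀ x → x ∈ p) → n ≤ ∣ p ∣
∀∈⇒n≤∣p∣ {p = p} all∈ = subst (_≤ ∣ p ∣) (∣⊤∣≡n _) (p⊆q⇒∣p∣≤∣q∣ {p = ⊤} (λ {x} _ → all∈ x))

∀∈⊎∃∉ : (p : Subset n) → (∀ x → x ∈ p) ⊎ ∃ (_∉ p)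
∀∈⊎∃∉ p with any? (λ x → ¬? (x ∈? p))
... | yes ∃∉ = inj₂ ∃∉
... | no ∄∉  = inj₁ (λ x → decidable-stable (x ∈? p) (λ x∉p → ∄∉ (x , x∉p)))

∣p++q∣≡∣p∣+∣q∣ : (p : Subset n) (q : Subset m) → ∣ p ++ q ∣ ≡ ∣ p ∣ + ∣ q ∣
∣p++q∣≡∣p∣+∣q∣ []            q = refl
∣p++q∣≡∣p∣+∣q∣ (inside  ∷ p) q = cong suc (∣p++q∣≡∣p∣+∣q∣ p q)
∣p++q∣≡∣p∣+∣q∣ (outside ∷ p) q = ∣p++q∣≡∣p∣+∣q∣ p q

↑ˡ∈++⁺ : ∀ (p : Subset n) (q : Subset m) {x} → x ∈ p → x ↑ˡ m ∈ p ++ q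
↑ˡ∈++⁺ (_ ∷ _) q here        = here
↑ˡ∈++⁺ (_ ∷ p) q (there x∈p) = there (↑ˡ∈++⁺ p q x∈p)

↑ˡ∈++⁻ : ∀ (p : Subset n) (q : Subset m) {x} → x ↑ˡ m ∈ p ++ q → x ∈ p
↑ˡ∈++⁻ (_ ∷ _) q {Fin.zero}  here       = here
↑ˡ∈++⁻ (_ ∷ p) q {Fin.suc _} (there x∈) = there (↑ˡ∈++⁻ p q x∈)

↑ʳ∈++⁺ : ∀ (p : Subset n) (q : Subset m) {y} → y ∈ q → n ↑ʳ y ∈ p ++ q
↑ʳ∈++⁺ []      q y∈q = y∈q
↑ʳ∈++⁺ (_ ∷ p) q y∈q = there (↑ʳ∈++⁺ p q y∈q)

↑ʳ∈++⁻ : ∀ (p : Subset n) (q : Subset m) {y} → n ↑ʳ y ∈ p ++ q → y ∈ q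
↑ʳ∈++⁻ []      q y∈         = y∈
↑ʳ∈++⁻ (_ ∷ p) q (there y∈) = ↑ʳ∈++⁻ p q y∈

++⁺-⊆ : ∀ {p p′ : Subset n} {q q′ : Subset m} → p ⊆ p′ → q ⊆ q′ → p ++ q ⊆ p′ ++ q′
++⁺-⊆ {p = []}    {p′ = []}    _    q⊆q′ = q⊆q′
++⁺-⊆ {p = _ ∷ _} {p′ = _ ∷ _} p⊆p′ _    here with p⊆p′ here
... | here = here
++⁺-⊆ {p = _ ∷ _} {p′ = _ ∷ _} p⊆p′ q⊆q′ (there x∈) = there (++⁺-⊆ (drop-∷-⊆ p⊆p′) q⊆q′ x∈)

++⁺-⊂ˡ : ∀ {p p′ : Subset n} (q : Subset m) → p ⊂ p′ → p ++ q ⊂ p′ ++ q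
++⁺-⊂ˡ {p = p} {p′} q (p⊆p′ , x , x∈p′ , x∉p) =
  ++⁺-⊆ p⊆p′ id , x ↑ˡ _ , ↑ˡ∈++⁺ p′ q x∈p′ , x∉p ∘ ↑ˡ∈++⁻ p q

++⁺-⊂ʳ : ∀ (p : Subset n) {q q′ : Subset m} → q ⊂ q′ → p ++ q ⊂ p ++ q′
++⁺-⊂ʳ p {q} {q′} (q⊆q′ , y , y∈q′ , y∉q) =
  ++⁺-⊆ id q⊆q′ , _ ↑ʳ y , ↑ʳ∈++⁺ p q′ y∈q′ , y∉q ∘ ↑ʳ∈++⁻ p q

-- Lazy burning and skew forcing in general

module _ (H : Hypergraph) where
  open Hypergraph H

  Burned-mono : ∀ {B B′} → B ⊆ B′ → ∀ {v} → Burned H B v → Burned H B′ v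
  Burned-mono B⊆B′ (initial v∈B)      = initial (B⊆B′ v∈B)
  Burned-mono B⊆B′ (spread h v∈h rest) = spread h v∈h (λ u u∈h u≢v → Burned-mono B⊆B′ (rest u u∈h u≢v))

  BurnsFrom : Subset nV → Fin nE → Fin nV → Set
  BurnsFrom B h v = v ∈ edge h × v ∉ B × (∀ u → u ∈ edge h → u ≢ v → u ∈ B)

  -- If a premise of the last burn lies outside B, it was burned earlier: recurse into it.
  Burned⇒burnsFrom : ∀ {B w} → Burned H B w → w ∉ B → ∃₂ (BurnsFrom B)
  Burned⇒burnsFrom (initial w∈B) w∉B = contradiction w∈B w∉B
  Burned⇒burnsFrom {B} {w} (spread h w∈h rest) w∉B
    with any? (λ u → (u ∈? edge h) ×-dec ¬? (u ≟ᶠ w) ×-dec ¬? (u ∈? B))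
  ... | yes (u , u∈h , u≢w , u∉B) = Burned⇒burnsFrom (rest u u∈h u≢w) u∉B
  ... | no ∄ = h , w , w∈h , w∉B ,
               λ u u∈h u≢w → decidable-stable (u ∈? B) (λ u∉B → ∄ (u , u∈h , u≢w , u∉B))

module _ (G : Graph) where
  open Graph G

  Black-mono : ∀ {S S′} → S ⊆ S′ → ∀ {w} → Black G S w → Black G S′ w
  Black-mono S⊆S′ (initial w∈S)      = initial (S⊆S′ w∈S)
  Black-mono S⊆S′ (force u u~w rest) = force u u~w (λ x u~x x≢w → Black-mono S⊆S′ (rest x u~x x≢w))

  ForcesFrom : Subset N → Fin N → Fin N → Set
  ForcesFrom S u w = adj u w × w ∉ S × (∀ x → adj u x → x ≢ w → x ∈ S)

  Black⇒forcesFrom : Decidable adj → ∀ {S w} → Black G S w → w ∉ S → ∃₂ (ForcesFrom S)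
  Black⇒forcesFrom adj? (initial w∈S) w∉S = contradiction w∈S w∉S
  Black⇒forcesFrom adj? {S} {w} (force u u~w rest) w∉S
    with any? (λ x → adj? u x ×-dec ¬? (x ≟ᶠ w) ×-dec ¬? (x ∈? S))
  ... | yes (x , u~x , x≢w , x∉S) = Black⇒forcesFrom adj? (rest x u~x x≢w) x∉S
  ... | no ∄ = u , w , u~w , w∉S ,
               λ x u~x x≢w → decidable-stable (x ∈? S) (λ x∉S → ∄ (x , u~x , x≢w , x∉S))

-- The incidence graph

IGadj′? : ∀ {n m} (edge : Fin m → Subset n) → (x y : Fin n ⊎ Fin m) → Dec (IGadj′ edge x y)
IGadj′? edge (inj₁ _) (inj₁ _) = no λ ()
IGadj′? edge (inj₁ v) (inj₂ h) = v ∈? edge h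
IGadj′? edge (inj₂ h) (inj₁ v) = v ∈? edge h
IGadj′? edge (inj₂ _) (inj₂ _) = no λ ()

module Incidence (H : Hypergraph) where
  open Hypergraph H renaming (edge to E)
  open Graph (IG H) using (adj; adj-sym)

  ιv : Fin nV → Fin (nV + nE)
  ιv v = v ↑ˡ nE

  ιe : Fin nE → Fin (nV + nE)
  ιe h = nV ↑ʳ h

  data VertexOrEdge : Fin (nV + nE) → Set where
    vertex : (v : Fin nV) → VertexOrEdge (ιv v)
    edge   : (h : Fin nE) → VertexOrEdge (ιe h)

  vertexOrEdge : (x : Fin (nV + nE)) → VertexOrEdge x
  vertexOrEdge x with splitAt nV x in eq
  ... | inj₁ v = subst VertexOrEdge (splitAt⁻¹-↑ˡ eq) (vertex v)
  ... | inj₂ h = subst VertexOrEdge (splitAt⁻¹-↑ʳ eq) (edge h)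

  adj? : Decidable adj
  adj? x y = IGadj′? E (splitAt nV x) (splitAt nV y)

  ∈⇒adj : ∀ {v h} → v ∈ E h → adj (ιe h) (ιv v)
  ∈⇒adj {v} {h} v∈h rewrite splitAt-↑ʳ nV nE h | splitAt-↑ˡ nV v nE = v∈h

  adj⇒∈ : ∀ {v h} → adj (ιe h) (ιv v) → v ∈ E h
  adj⇒∈ {v} {h} h~v rewrite splitAt-↑ʳ nV nE h | splitAt-↑ˡ nV v nE = h~v

  ¬adj-ιv-ιv : ∀ {v v′} → ¬ adj (ιv v) (ιv v′)
  ¬adj-ιv-ιv {v} {v′} rewrite splitAt-↑ˡ nV v nE | splitAt-↑ˡ nV v′ nE = λ ()

  ¬adj-ιe-ιe : ∀ {h h′} → ¬ adj (ιe h) (ιe h′)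
  ¬adj-ιe-ιe {h} {h′} rewrite splitAt-↑ʳ nV nE h | splitAt-↑ʳ nV nE h′ = λ ()

  burned⇒black : ∀ {p q v} → Burned H p v → Black (IG H) (p ++ q) (ιv v)
  burned⇒black {p} {q} (initial v∈p) = initial (↑ˡ∈++⁺ p q v∈p)
  burned⇒black {p} {q} {v} (spread h v∈h rest) = force (ιe h) (∈⇒adj v∈h) blackNeighbour
    where
    blackNeighbour : ∀ x → adj (ιe h) x → x ≢ ιv v → Black (IG H) (p ++ q) x
    blackNeighbour x h~x x≢v with vertexOrEdge x
    ... | vertex u = burned⇒black (rest u (adj⇒∈ h~x) (x≢v ∘ cong ιv))
    ... | edge _   = contradiction h~x ¬adj-ιe-ιe

  black⇒burned : ∀ {p q x} → Black (IG H) (p ++ q) x → ∀ {v} → x ≡ ιv v → Burned H p v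
  black⇒burned {p} {q} (initial x∈) refl = initial (↑ˡ∈++⁻ p q x∈)
  black⇒burned (force u u~v rest) {v} refl with vertexOrEdge u
  ... | vertex _ = contradiction u~v ¬adj-ιv-ιv
  ... | edge h   = spread h (adj⇒∈ u~v) λ w w∈h w≢v →
                     black⇒burned (rest (ιv w) (∈⇒adj w∈h) (w≢v ∘ ↑ˡ-injective nE w v)) refl

  MeetsOutside : Subset nV → Fin nE → Set
  MeetsOutside B h = ∃ λ v → v ∈ E h × v ∉ B

  -- The edges through which the vertices outside B get burned, one per vertex.  Once all
  -- vertices are black they can be forced in reverse order of burning: the vertex burned through h
  -- forces h, as each of its other edges either burned a later vertex or is not recorded.
  record BurningEdges (B : Subset nV) : Set where
    field
      edges      : Subset nE
      enough     : nV ≤ ∣ edges ∣ + ∣ B ∣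
      meet       : ∀ {h} → h ∈ edges → MeetsOutside B h
      forcedLast : ∀ S → (∀ v → Black (IG H) S (ιv v)) →
                   (∀ h → h ∉ edges → MeetsOutside B h → Black (IG H) S (ιe h)) →
                   ∀ h → h ∈ edges → Black (IG H) S (ιe h)

  module BurningEdgesStep {B h₀ v} (v∈h₀ : v ∈ E h₀) (v∉B : v ∉ B)
                          (h₀∖v⊆B : ∀ u → u ∈ E h₀ → u ≢ v → u ∈ B)
                          (later : BurningEdges (B ∪ ⁅ v ⁆)) where
    open BurningEdges later renaming (edges to U′)

    B⊆B′ : B ⊆ B ∪ ⁅ v ⁆
    B⊆B′ = p⊆p∪q ⁅ v ⁆

    h₀⊆B′ : ∀ u → u ∈ E h₀ → u ∈ B ∪ ⁅ v ⁆
    h₀⊆B′ u u∈h₀ with u ≟ᶠ v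
    ... | yes refl = x∈p∪q⁺ (inj₂ (x∈⁅x⁆ v))
    ... | no u≢v   = B⊆B′ (h₀∖v⊆B u u∈h₀ u≢v)

    ¬meetsOutside-h₀ : ¬ MeetsOutside (B ∪ ⁅ v ⁆) h₀
    ¬meetsOutside-h₀ (u , u∈h₀ , u∉B′) = u∉B′ (h₀⊆B′ u u∈h₀)

    h₀∉U′ : h₀ ∉ U′
    h₀∉U′ = ¬meetsOutside-h₀ ∘ meet

    U : Subset nE
    U = U′ ∪ ⁅ h₀ ⁆

    enough′ : nV ≤ ∣ U ∣ + ∣ B ∣
    enough′ = begin
      nV                       ≤⟨ enough ⟩
      ∣ U′ ∣ + ∣ B ∪ ⁅ v ⁆ ∣    ≤⟨ +-monoʳ-≤ ∣ U′ ∣ (∣p∪⁅x⁆∣≤1+∣p∣ B v) ⟩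
      ∣ U′ ∣ + suc ∣ B ∣        ≡⟨ +-suc ∣ U′ ∣ ∣ B ∣ ⟩
      suc ∣ U′ ∣ + ∣ B ∣        ≤⟨ +-monoˡ-≤ ∣ B ∣ (p⊂q⇒∣p∣<∣q∣ (x∉p⇒p⊂p∪⁅x⁆ h₀∉U′)) ⟩
      ∣ U ∣ + ∣ B ∣             ∎
      where open ≤-Reasoning

    meet′ : ∀ {h} → h ∈ U → MeetsOutside B h
    meet′ h∈U with x∈p∪⁅y⁆⁻ h∈U
    ... | inj₂ refl = v , v∈h₀ , v∉B
    ... | inj₁ h∈U′ = let (u , u∈h , u∉B′) = meet h∈U′ in u , u∈h , u∉B′ ∘ B⊆B′

    forcedLast′ : ∀ S → (∀ v → Black (IG H) S (ιv v)) →
                  (∀ h → h ∉ U → MeetsOutside B h → Black (IG H) S (ιe h)) →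
                  ∀ h → h ∈ U → Black (IG H) S (ιe h)
    forcedLast′ S allBlack blackOutside h h∈U = Sum.[ blackU′ h , (λ { refl → blackH₀ }) ] (x∈p∪⁅y⁆⁻ h∈U)
      where
      outside′ : ∀ h → h ∉ U′ → MeetsOutside (B ∪ ⁅ v ⁆) h → Black (IG H) S (ιe h)
      outside′ h h∉U′ (u , u∈h , u∉B′) with h ≟ᶠ h₀
      ... | yes refl = contradiction (u , u∈h , u∉B′) ¬meetsOutside-h₀
      ... | no h≢h₀  = blackOutside h (x∉p∧x≢y⇒x∉p∪⁅y⁆ h∉U′ h≢h₀) (u , u∈h , u∉B′ ∘ B⊆B′)

      blackU′ : ∀ h → h ∈ U′ → Black (IG H) S (ιe h)
      blackU′ = forcedLast S allBlack outside′

      blackNeighbour : ∀ x → adj (ιv v) x → x ≢ ιe h₀ → Black (IG H) S x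
      blackNeighbour x v~x x≢h₀ with vertexOrEdge x
      ... | vertex _ = contradiction v~x ¬adj-ιv-ιv
      ... | edge h with h ∈? U′
      ...   | yes h∈U′ = blackU′ h h∈U′
      ...   | no h∉U′  = blackOutside h (x∉p∧x≢y⇒x∉p∪⁅y⁆ h∉U′ (x≢h₀ ∘ cong ιe))
                                   (v , adj⇒∈ (adj-sym _ _ v~x) , v∉B)

      blackH₀ : Black (IG H) S (ιe h₀)
      blackH₀ = force (ιv v) (adj-sym _ _ (∈⇒adj v∈h₀)) blackNeighbour

  burningEdges-step : ∀ {B h₀ v} → BurnsFrom H B h₀ v → BurningEdges (B ∪ ⁅ v ⁆) → BurningEdges B
  burningEdges-step (v∈h₀ , v∉B , h₀∖v⊆B) later = record
    { edges = U ; enough = enough′ ; meet = meet′ ; forcedLast = forcedLast′ }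
    where open BurningEdgesStep v∈h₀ v∉B h₀∖v⊆B later

  burningEdges : ∀ {B} → Acc _⊃_ B → LazyBurningSet H B → BurningEdges B
  burningEdges {B} (acc larger) burning with ∀∈⊎∃∉ B
  ... | inj₁ B-full = record
    { edges      = ∅
    ; enough     = subst (λ k → nV ≤ k + ∣ B ∣) (sym (∣⊥∣≡0 nE)) (∀∈⇒n≤∣p∣ B-full)
    ; meet       = λ h∈∅ → contradiction h∈∅ ∉⊥
    ; forcedLast = λ _ _ _ _ h∈∅ → contradiction h∈∅ ∉⊥
    }
  ... | inj₂ (w , w∉B) with Burned⇒burnsFrom H (burning w) w∉B
  ... | h₀ , v , burns@(_ , v∉B , _) =
    burningEdges-step burns
      (burningEdges (larger (x∉p⇒p⊂p∪⁅x⁆ v∉B)) (Burned-mono H (p⊆p∪q ⁅ v ⁆) ∘ burning))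

  skewForcingSet : ∀ {B} → LazyBurningSet H B → (U : BurningEdges B) →
                   SkewForcingSet (IG H) (B ++ ∁ (BurningEdges.edges U))
  skewForcingSet {B} burning record { edges = U ; forcedLast = forcedLast } = black
    where
    unusedBlack : ∀ h → h ∉ U → Black (IG H) (B ++ ∁ U) (ιe h)
    unusedBlack h h∉U = initial (↑ʳ∈++⁺ B (∁ U) (x∉p⇒x∈∁p h∉U))

    black : SkewForcingSet (IG H) (B ++ ∁ U)
    black x with vertexOrEdge x
    ... | vertex v = burned⇒black (burning v)
    ... | edge h with h ∈? U
    ...   | yes h∈U = forcedLast _ (burned⇒black ∘ burning) (λ h h∉U _ → unusedBlack h h∉U) h h∈U
    ...   | no h∉U  = unusedBlack h h∉U

  z+nV≤2b+nE : ∀ {z b} → IsSkewZeroForcingNumber (IG H) z → IsLazyBurningNumber H b → z + nV ≤ 2 * b + nE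
  z+nV≤2b+nE {z} (_ , minimal) ((B , burning , refl) , _) = begin
    z + nV                              ≤⟨ +-monoˡ-≤ nV (minimal _ (skewForcingSet burning BE)) ⟩
    ∣ B ++ ∁ U ∣ + nV                   ≡⟨ cong (_+ nV) (∣p++q∣≡∣p∣+∣q∣ B (∁ U)) ⟩
    (∣ B ∣ + ∣ ∁ U ∣) + nV              ≤⟨ +-monoʳ-≤ (∣ B ∣ + ∣ ∁ U ∣) (BurningEdges.enough BE) ⟩
    (∣ B ∣ + ∣ ∁ U ∣) + (∣ U ∣ + ∣ B ∣)  ≡⟨ regroup (∣ B ∣) (∣ ∁ U ∣) (∣ U ∣) ⟩
    2 * ∣ B ∣ + (∣ ∁ U ∣ + ∣ U ∣)        ≡⟨ cong (2 * ∣ B ∣ +_) (∣∁p∣+∣p∣≡n U) ⟩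
    2 * ∣ B ∣ + nE                      ∎
    where
    open ≤-Reasoning
    BE = burningEdges (⊃-wellFounded B) burning
    U = BurningEdges.edges BE
    regroup : ∀ b c u → b + c + (u + b) ≡ 2 * b + (c + u)
    regroup = solve-∀

  data BurnedAvoiding (X : Subset nE) (B : Subset nV) : Fin nV → Set where
    initial : ∀ {v} → v ∈ B → BurnedAvoiding X B v
    spread  : ∀ {v} h → h ∉ X → v ∈ E h → (∀ u → u ∈ E h → u ≢ v → BurnedAvoiding X B u) →
              BurnedAvoiding X B v

  BurnedAvoiding⇒Burned : ∀ {X B v} → BurnedAvoiding X B v → Burned H B v
  BurnedAvoiding⇒Burned (initial v∈B)        = initial v∈B
  BurnedAvoiding⇒Burned (spread h _ v∈h rest) =
    spread h v∈h (λ u u∈h u≢v → BurnedAvoiding⇒Burned (rest u u∈h u≢v))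

  record SmallBurningSetAvoiding (X : Subset nE) : Set where
    field
      burningSet : Subset nV
      small      : ∣ burningSet ∣ + nE ≤ nV + ∣ X ∣
      burns      : ∀ v → BurnedAvoiding X burningSet v

  -- Reversing a skew force of h₀ by v: every other edge at v is already in X, so v can only
  -- have been an initial vertex, and it burns instead through h₀ once h₀ leaves X.
  module _ {X : Subset nE} {h₀ v} (h₀∉X : h₀ ∉ X) (v∈h₀ : v ∈ E h₀)
           (edgesAt-v : ∀ h → v ∈ E h → h ≢ h₀ → h ∈ X) where

    edgesAt-v⊆X∪⁅h₀⁆ : ∀ h → v ∈ E h → h ∈ X ∪ ⁅ h₀ ⁆
    edgesAt-v⊆X∪⁅h₀⁆ h v∈h with h ≟ᶠ h₀
    ... | yes refl = x∈p∪q⁺ (inj₂ (x∈⁅x⁆ h₀))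
    ... | no h≢h₀  = x∈p∪q⁺ (inj₁ (edgesAt-v h v∈h h≢h₀))

    burnedAvoiding⇒initial : ∀ {B} → BurnedAvoiding (X ∪ ⁅ h₀ ⁆) B v → v ∈ B
    burnedAvoiding⇒initial (initial v∈B)         = v∈B
    burnedAvoiding⇒initial (spread h h∉X∪h₀ v∈h _) = contradiction (edgesAt-v⊆X∪⁅h₀⁆ h v∈h) h∉X∪h₀

    burnedAvoiding-remove : ∀ {B u} → BurnedAvoiding (X ∪ ⁅ h₀ ⁆) B u → u ≢ v → BurnedAvoiding X (B - v) u
    burnedAvoiding-remove (initial u∈B) u≢v = initial (x∈p∧x≢y⇒x∈p-y u∈B u≢v)
    burnedAvoiding-remove (spread h h∉X∪h₀ u∈h rest) _ =
      spread h (h∉X∪h₀ ∘ p⊆p∪q ⁅ h₀ ⁆) u∈h λ w w∈h w≢u →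
        burnedAvoiding-remove (rest w w∈h w≢u) λ { refl → h∉X∪h₀ (edgesAt-v⊆X∪⁅h₀⁆ h w∈h) }

    unforce : SmallBurningSetAvoiding (X ∪ ⁅ h₀ ⁆) → SmallBurningSetAvoiding X
    unforce record { burningSet = B ; small = small ; burns = burning } =
      record { burningSet = B - v ; small = small′ ; burns = burning′ }
      where
      burning′ : ∀ u → BurnedAvoiding X (B - v) u
      burning′ u with u ≟ᶠ v
      ... | no u≢v   = burnedAvoiding-remove (burning u) u≢v
      ... | yes refl = spread h₀ h₀∉X v∈h₀ λ w _ w≢v → burnedAvoiding-remove (burning w) w≢v

      small′ : ∣ B - v ∣ + nE ≤ nV + ∣ X ∣
      small′ = s≤s⁻¹ (begin
        suc ∣ B - v ∣ + nE      ≤⟨ +-monoˡ-≤ nE (x∈p⇒∣p-x∣<∣p∣ (burnedAvoiding⇒initial (burning v))) ⟩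
        ∣ B ∣ + nE              ≤⟨ small ⟩
        nV + ∣ X ∪ ⁅ h₀ ⁆ ∣     ≤⟨ +-monoʳ-≤ nV (∣p∪⁅x⁆∣≤1+∣p∣ X h₀) ⟩
        nV + suc ∣ X ∣          ≡⟨ +-suc nV ∣ X ∣ ⟩
        suc (nV + ∣ X ∣)        ∎)
        where open ≤-Reasoning

  smallBurningSetAvoiding : ∀ p q → Acc _⊃_ (p ++ q) → SkewForcingSet (IG H) (p ++ q) →
                            SmallBurningSetAvoiding q
  smallBurningSetAvoiding p q (acc larger) forcing with ∀∈⊎∃∉ (p ++ q)
  ... | inj₁ full = record { burningSet = ⊤ ; small = small ; burns = λ _ → initial ∈⊤ }
    where
    small : ∣ ⊤ {nV} ∣ + nE ≤ nV + ∣ q ∣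
    small = subst (λ k → k + nE ≤ nV + ∣ q ∣) (sym (∣⊤∣≡n nV))
              (+-monoʳ-≤ nV (∀∈⇒n≤∣p∣ {p = q} (λ h → ↑ʳ∈++⁻ p q (full (ιe h)))))
  ... | inj₂ (w , w∉S) with Black⇒forcesFrom (IG H) adj? (forcing w) w∉S
  ... | u , w′ , u~w′ , w′∉S , others with vertexOrEdge w′
  ...   | vertex v =
    smallBurningSetAvoiding (p ∪ ⁅ v ⁆) q (larger (++⁺-⊂ˡ q (x∉p⇒p⊂p∪⁅x⁆ v∉p)))
      (Black-mono (IG H) (++⁺-⊆ {p = p} {q = q} (p⊆p∪q ⁅ v ⁆) id) ∘ forcing)
    where
    v∉p : v ∉ p
    v∉p = w′∉S ∘ ↑ˡ∈++⁺ p q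
  ...   | edge h₀ with vertexOrEdge u
  ...     | edge _   = contradiction u~w′ ¬adj-ιe-ιe
  ...     | vertex v =
    unforce h₀∉q (adj⇒∈ (adj-sym _ _ u~w′)) edgesAt-v
      (smallBurningSetAvoiding p (q ∪ ⁅ h₀ ⁆) (larger (++⁺-⊂ʳ p (x∉p⇒p⊂p∪⁅x⁆ h₀∉q)))
        (Black-mono (IG H) (++⁺-⊆ {p = p} {q = q} id (p⊆p∪q ⁅ h₀ ⁆)) ∘ forcing))
    where
    h₀∉q : h₀ ∉ q
    h₀∉q = w′∉S ∘ ↑ʳ∈++⁺ p q

    edgesAt-v : ∀ h → v ∈ E h → h ≢ h₀ → h ∈ q
    edgesAt-v h v∈h h≢h₀ =
      ↑ʳ∈++⁻ p q (others (ιe h) (adj-sym _ _ (∈⇒adj v∈h)) (h≢h₀ ∘ ↑ʳ-injective nV h h₀))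

  2b+nE≤z+nV : ∀ {z b} → IsSkewZeroForcingNumber (IG H) z → IsLazyBurningNumber H b → 2 * b + nE ≤ z + nV
  2b+nE≤z+nV {b = b} ((S , forcing , refl) , _) (_ , minimal) with Vec.splitAt nV S
  ... | p , q , refl = begin
    2 * b + nE                ≡⟨ regroup b nE ⟩
    b + (b + nE)              ≤⟨ +-mono-≤ b≤∣p∣ (+-monoˡ-≤ nE b≤∣B∣) ⟩
    ∣ p ∣ + (∣ B ∣ + nE)        ≤⟨ +-monoʳ-≤ ∣ p ∣ small ⟩
    ∣ p ∣ + (nV + ∣ q ∣)        ≡⟨ regroup′ (∣ p ∣) nV (∣ q ∣) ⟩
    (∣ p ∣ + ∣ q ∣) + nV        ≡⟨ cong (_+ nV) (sym (∣p++q∣≡∣p∣+∣q∣ p q)) ⟩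
    ∣ p ++ q ∣ + nV            ∎
    where
    open ≤-Reasoning
    open SmallBurningSetAvoiding (smallBurningSetAvoiding p q (⊃-wellFounded (p ++ q)) forcing)
      renaming (burningSet to B)
    b≤∣p∣ : b ≤ ∣ p ∣
    b≤∣p∣ = minimal p (λ v → black⇒burned (forcing (ιv v)) refl)
    b≤∣B∣ : b ≤ ∣ B ∣
    b≤∣B∣ = minimal B (BurnedAvoiding⇒Burned ∘ burns)
    regroup : ∀ b e → 2 * b + e ≡ b + (b + e)
    regroup = solve-∀
    regroup′ : ∀ a n c → a + (n + c) ≡ (a + c) + n
    regroup′ = solve-∀

corollary4p10 : (H : Hypergraph) (z b : ℕ) →
    IsSkewZeroForcingNumber (IG H) z → IsLazyBurningNumber H b →
    z + Hypergraph.nV H ≡ 2 * b + Hypergraph.nE H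
corollary4p10 H z b zeroForcing lazyBurning =
  ≤-antisym (z+nV≤2b+nE zeroForcing lazyBurning) (2b+nE≤z+nV zeroForcing lazyBurning)
  where open Incidence H
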